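{- Let $T$ be a DFS tree of a 2-vertex-connected graph $G$ and let $\mathcal{C}$ be the chain decomposition of $G$ with respect to $T$. For every separation pair $\{x,y\}$ of $G$, the vertices $x$ and $y$ are contained in a common chain $C\in\mathcal{C}$.
   Context: Graphs are finite, undirected, may have parallel edges, no self-loops, minimum degree at least three. A separation pair is a pair of vertices $\{x,y\}$ such that $G-x-y$ is disconnected. $T$ is a DFS tree rooted at $r$; non-tree edges (back-edges) join a vertex to a proper ancestor and are oriented from the ancestor to the descendant. Chain decomposition: initially no vertex is visited; processing vertices $v$ in DFS discovery order, declare $v$ visited, then for each back-edge from $v$ to $w$ walk the tree path from $w$ towards $r$ until the first already visited vertex $x'$; the back-edge plus the tree path from $w$ to $x'$ forms a chain (a path or cycle), and its inner vertices are declared visited. A vertex is contained in a chain if it is a vertex of that path or cycle. -}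

module Defs where

open import Data.Nat using (ℕ; zero; suc; _≤_; _<_; _≤ᵇ_)
open import Data.Fin using (Fin; _≟_)
open import Data.Fin.Properties using ()
open import Data.Bool using (Bool; true; false; if_then_else_; _∨_)
open import Data.List using (List; []; _∷_; length; filter)
open import Data.Bool.ListAction using (any)
open import Data.List.Base using (allFin)
open import Data.List.Membership.Propositional using (_∈_)
open import Data.List.Relation.Unary.AllPairs using (AllPairs)
open import Data.List.Relation.Unary.Unique.Propositional using (Unique)
open import Data.Product using (_×_; _,_; proj₁; proj₂; Σ; ∃)
open import Data.Sum using (_⊎_)
open import Data.Empty using (⊥)
open import Relation.Nullary using (¬_; Dec; yes; no)
open import Relation.Nullary.Decidable using (⌊_⌋; _⊎-dec_)
open import Relation.Binary.PropositionalEquality using (_≡_; _≢_)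

record Multigraph : Set where
  field
    n : ℕ
    m : ℕ
    ends : Fin m → Fin n × Fin n
    loopless : ∀ e → proj₁ (ends e) ≢ proj₂ (ends e)

module _ (G : Multigraph) where
  open Multigraph G

  Joins : Fin m → Fin n → Fin n → Set
  Joins e u v = ends e ≡ (u , v) ⊎ ends e ≡ (v , u)

  incident? : (v : Fin n) (e : Fin m) → Dec (proj₁ (ends e) ≡ v ⊎ proj₂ (ends e) ≡ v)
  incident? v e = (proj₁ (ends e) ≟ v) ⊎-dec (proj₂ (ends e) ≟ v)

  degree : Fin n → ℕ
  degree v = length (filter (incident? v) (allFin m))

  MinDegree≥3 : Set
  MinDegree≥3 = ∀ v → 3 ≤ degree v

  data Reach (Rem : Fin n → Set) : Fin n → Fin n → Set where
    here : ∀ {u} → ¬ Rem u → Reach Rem u u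
    step : ∀ {u v w} (e : Fin m) → Joins e u v → ¬ Rem u →
           Reach Rem v w → Reach Rem u w

  ConnectedWithout : (Fin n → Set) → Set
  ConnectedWithout Rem = ∀ u v → ¬ Rem u → ¬ Rem v → Reach Rem u v

  TwoConnected : Set
  TwoConnected = 2 < n × ConnectedWithout (λ _ → ⊥)
                 × (∀ z → ConnectedWithout (λ w → w ≡ z))

  SeparationPair : Fin n → Fin n → Set
  SeparationPair x y =
    x ≢ y × Σ (Fin n) λ u → Σ (Fin n) λ v →
      let Rem = λ w → w ≡ x ⊎ w ≡ y in
      ¬ Rem u × ¬ Rem v × ¬ Reach Rem u v

  -- Rooted trees given by a parent function (parent of root unused).

  data Ancestor (root : Fin n) (parent : Fin n → Fin n) : Fin n → Fin n → Set where
    anc-refl : ∀ {a} → Ancestor root parent a a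
    anc-step : ∀ {a v} → v ≢ root → Ancestor root parent a (parent v) →
               Ancestor root parent a v

  -- A DFS tree of G: a spanning tree rooted at root, given by parent
  -- pointers and a choice of tree edge for each non-root vertex, together
  -- with the discovery times of the DFS (a preorder of the tree), such
  -- that every non-tree edge joins a vertex to one of its ancestors.
  record DFSTree : Set where
    field
      root     : Fin n
      parent   : Fin n → Fin n
      time     : Fin n → ℕ
      treeEdge : Fin n → Fin m
      time-injective : ∀ u v → time u ≡ time v → u ≡ v
      parent-earlier : ∀ v → v ≢ root → time (parent v) < time v
      treeEdge-joins : ∀ v → v ≢ root → Joins (treeEdge v) v (parent v)
      -- discovery order is a preorder: every subtree is an interval
      preorder : ∀ a u w → Ancestor root parent a u →
                 time a ≤ time w → time w ≤ time u → Ancestor root parent a w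

    IsTreeEdge : Fin m → Set
    IsTreeEdge e = Σ (Fin n) λ v → v ≢ root × treeEdge v ≡ e

    field
      nontree-ancestral : ∀ e → ¬ IsTreeEdge e →
        Ancestor root parent (proj₁ (ends e)) (proj₂ (ends e)) ⊎
        Ancestor root parent (proj₂ (ends e)) (proj₁ (ends e))

    -- orientation of a back-edge: from the ancestor (earlier) end
    -- to the descendant (later) end
    top : Fin m → Fin n
    top e = if time (proj₁ (ends e)) ≤ᵇ time (proj₂ (ends e))
            then proj₁ (ends e) else proj₂ (ends e)

    bot : Fin m → Fin n
    bot e = if time (proj₁ (ends e)) ≤ᵇ time (proj₂ (ends e))
            then proj₂ (ends e) else proj₁ (ends e)

    -- An order in which the chain decomposition processes the back-edges:
    -- every back-edge exactly once, grouped by their source vertex v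
    -- in DFS discovery order (back-edges at the same v in arbitrary order).
    record BackEdgeOrder (bes : List (Fin m)) : Set where
      field
        complete : ∀ e → ¬ IsTreeEdge e → e ∈ bes
        sound    : ∀ e → e ∈ bes → ¬ IsTreeEdge e
        unique   : Unique bes
        sorted   : AllPairs (λ e f → time (top e) ≤ time (top f)) bes

    -- walk from w towards the root until the first visited vertex
    -- (inclusive); the fuel n suffices as the root is always visited.
    walk : (Fin n → Bool) → ℕ → Fin n → List (Fin n)
    walk vis zero    w = w ∷ []
    walk vis (suc k) w = if vis w then w ∷ [] else w ∷ walk vis k (parent w)

    -- innerVis: vertices declared visited as inner vertices of earlier
    -- chains.  When the back-edge e from v = top e is processed, the
    -- visited vertices are those discovered no later than v (they have
    -- been processed) together with innerVis.
    chainsFrom : (Fin n → Bool) → List (Fin m) → List (List (Fin n))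
    chainsFrom iv [] = []
    chainsFrom iv (e ∷ es) =
      (top e ∷ W) ∷ chainsFrom (λ u → iv u ∨ any (λ z → ⌊ z ≟ u ⌋) W) es
      where
        vis : Fin n → Bool
        vis u = (time u ≤ᵇ time (top e)) ∨ iv u
        W : List (Fin n)
        W = walk vis n (bot e)

    -- the chain decomposition; each chain is given by its vertex list
    -- (v, w, ..., x') : back-edge v→w followed by the tree path w..x'
    chainDecomposition : List (Fin m) → List (List (Fin n))
    chainDecomposition = chainsFrom (λ _ → false)

-- If x and y are incomparable in
-- the DFS tree, every vertex of G − x − y reaches the root: a vertex below x
-- leaves its subtree, in G − x, through a back-edge to a proper ancestor of
-- x (and symmetrically for y).  So say x is a proper ancestor of y, with
-- child c towards y.  Then every vertex of G − x − y reaches a hub (the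
-- root, or c if x is the root) unless x and y already share a chain, which
-- happens in two ways, both instances of one lemma ("climbChain": the chain
-- of the first back-edge from above into a still unvisited subtree climbs
-- through that subtree):
--   * a subtree below a child of y attached to G only at x and y;
--   * the first back-edge from above x into the subtree of c ends below y
--     (otherwise that back-edge connects the vertices between x and y with
--     the vertices above x).

module Submission where

open import Defs
open import Data.Fin using (Fin)
open import Data.List using (List)
open import Data.List.Membership.Propositional using (_∈_)
open import Data.Product using (_×_; Σ)

open import Function using (_∘_)
open import Data.Nat using (ℕ; zero; suc; _≤_; _<_; _≤ᵇ_; s≤s; _<?_)
open import Data.Nat.Properties hiding (_≟_)
open import Data.Fin as Fin using (_≟_)
open import Data.Fin.Properties using (any?; pigeonhole)
open import Data.Bool using (Bool; true; false; T; _∨_; if_then_else_)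
open import Data.Bool.ListAction using (any)
open import Data.List using ([]; _∷_)
open import Data.List.Membership.Propositional using (lose)
open import Data.List.Relation.Unary.Any using (Any; here; there)
open import Data.List.Relation.Unary.All using (lookupWith)
open import Data.List.Relation.Unary.AllPairs using (AllPairs; _∷_)
open import Data.Product using (_,_; proj₁; proj₂)
open import Data.Product.Properties using (,-injective)
open import Data.Sum using (_⊎_; inj₁; inj₂; [_,_]′)
open import Data.Empty using (⊥-elim)
open import Data.Unit using (tt)
open import Relation.Nullary using (¬_; Dec; yes; no)
open import Relation.Nullary.Decidable using (⌊_⌋; _×-dec_; _⊎-dec_; ¬?)
open import Relation.Binary.PropositionalEquality

≤ᵇ-true : ∀ {a b} → a ≤ b → (a ≤ᵇ b) ≡ true
≤ᵇ-true {a} {b} a≤b with a ≤ᵇ b | ≤⇒≤ᵇ {a} {b} a≤b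
... | true | _ = refl

≤ᵇ-false : ∀ {a b} → b < a → (a ≤ᵇ b) ≡ false
≤ᵇ-false {a} {b} b<a with a ≤ᵇ b in eq
... | true  = ⊥-elim (<⇒≱ b<a (≤ᵇ⇒≤ a b (subst T (sym eq) tt)))
... | false = refl

module DFS (G : Multigraph) (Tr : DFSTree G) where
  open Multigraph G
  open DFSTree Tr

  Anc : Fin n → Fin n → Set
  Anc = Ancestor G root parent

  anc-time : ∀ {a v} → Anc a v → time a ≤ time v
  anc-time anc-refl = ≤-refl
  anc-time (anc-step {v = v} v≢r a≤pv) = <⇒≤ (≤-<-trans (anc-time a≤pv) (parent-earlier v v≢r))

  before⇒≢ : ∀ {a b} → time a < time b → a ≢ b
  before⇒≢ a<b refl = <-irrefl refl a<b

  before⇒¬below : ∀ {d v} → time v < time d → ¬ Anc d v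
  before⇒¬below v<d d≤v = <⇒≱ v<d (anc-time d≤v)

  anc-trans : ∀ {a b c} → Anc a b → Anc b c → Anc a c
  anc-trans a≤b anc-refl = a≤b
  anc-trans a≤b (anc-step c≢r b≤pc) = anc-step c≢r (anc-trans a≤b b≤pc)

  anc-antisym : ∀ {a b} → Anc a b → Anc b a → a ≡ b
  anc-antisym a≤b b≤a = time-injective _ _ (≤-antisym (anc-time a≤b) (anc-time b≤a))

  anc-parent : ∀ {v} → v ≢ root → Anc (parent v) v
  anc-parent v≢r = anc-step v≢r anc-refl

  anc-proper : ∀ {a v} → Anc a v → a ≢ v → v ≢ root × Anc a (parent v)
  anc-proper anc-refl a≢v = ⊥-elim (a≢v refl)
  anc-proper (anc-step v≢r a≤pv) _ = v≢r , a≤pv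

  anc-root : ∀ {a} → Anc a root → a ≡ root
  anc-root anc-refl = refl
  anc-root (anc-step r≢r _) = ⊥-elim (r≢r refl)

  rootAnc : ∀ v → Anc root v
  rootAnc v = go (suc (time v)) v ≤-refl
    where
      go : ∀ k v → time v < k → Anc root v
      go (suc k) v v<k with v ≟ root
      ... | yes refl = anc-refl
      ... | no v≢r = anc-step v≢r (go k (parent v) (<-≤-trans (parent-earlier v v≢r) (≤-pred v<k)))

  anc? : ∀ a v → Dec (Anc a v)
  anc? a v = go (suc (time v)) v ≤-refl
    where
      go : ∀ k v → time v < k → Dec (Anc a v)
      go (suc k) v v<k with a ≟ v
      ... | yes refl = yes anc-refl
      ... | no a≢v with v ≟ root
      ...   | yes v≡r = no (λ a≤v → proj₁ (anc-proper a≤v a≢v) v≡r)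
      ...   | no v≢r with go k (parent v) (<-≤-trans (parent-earlier v v≢r) (≤-pred v<k))
      ...     | yes a≤pv = yes (anc-step v≢r a≤pv)
      ...     | no a≰pv = no (λ a≤v → a≰pv (proj₂ (anc-proper a≤v a≢v)))

  anc-cmp : ∀ {a b w} → Anc a w → Anc b w → Anc a b ⊎ Anc b a
  anc-cmp anc-refl b≤w = inj₂ b≤w
  anc-cmp (anc-step w≢r a≤pw) anc-refl = inj₁ (anc-step w≢r a≤pw)
  anc-cmp (anc-step _ a≤pw) (anc-step _ b≤pw) = anc-cmp a≤pw b≤pw

  childOf : ∀ {a w} → Anc a w → a ≢ w →
            Σ (Fin n) λ c → c ≢ root × parent c ≡ a × Anc c w
  childOf anc-refl a≢w = ⊥-elim (a≢w refl)
  childOf {a} (anc-step {v = w} w≢r a≤pw) _ with a ≟ parent w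
  ... | yes a≡pw = w , w≢r , sym a≡pw , anc-refl
  ... | no a≢pw with childOf a≤pw a≢pw
  ...   | c , c≢r , pc , c≤pw = c , c≢r , pc , anc-step w≢r c≤pw

  childOnPath : ∀ {c x w u} → c ≢ root → parent c ≡ x → Anc c w →
                Anc x u → Anc u w → u ≢ x → Anc c u
  childOnPath {c} {u = u} c≢r refl c≤w x≤u u≤w u≢x with anc-cmp c≤w u≤w
  ... | inj₁ c≤u = c≤u
  ... | inj₂ u≤c with u ≟ c
  ...   | yes refl = anc-refl
  ...   | no u≢c = ⊥-elim (u≢x (anc-antisym (proj₂ (anc-proper u≤c u≢c)) x≤u))

  siblingsDisjoint : ∀ {c c' w} → parent c ≡ parent c' → c ≢ root → c' ≢ root →
                     Anc c w → Anc c' w → c ≡ c'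
  siblingsDisjoint {c} {c'} pp c≢r c'≢r c≤w c'≤w with c ≟ c' | anc-cmp c≤w c'≤w
  ... | yes c≡c' | _ = c≡c'
  ... | no c≢c' | inj₁ c≤c' =
        ⊥-elim (<⇒≱ (parent-earlier c c≢r)
                     (anc-time (subst (Anc c) (sym pp) (proj₂ (anc-proper c≤c' c≢c')))))
  ... | no c≢c' | inj₂ c'≤c =
        ⊥-elim (<⇒≱ (parent-earlier c' c'≢r)
                     (anc-time (subst (Anc c') pp (proj₂ (anc-proper c'≤c (c≢c' ∘ sym))))))

  belowChild : ∀ {c x u} → c ≢ root → parent c ≡ x → Anc c u → time x < time u
  belowChild {c} c≢r refl c≤u = <-≤-trans (parent-earlier c c≢r) (anc-time c≤u)

  joins-sym : ∀ {e u v} → Joins G e u v → Joins G e v u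
  joins-sym (inj₁ eq) = inj₂ eq
  joins-sym (inj₂ eq) = inj₁ eq

  isTree? : ∀ e → Dec (IsTreeEdge e)
  isTree? e = any? (λ v → ¬? (v ≟ root) ×-dec (treeEdge v ≟ e))

  treeEnds : ∀ {e s t} → IsTreeEdge e → Joins G e s t →
             (s ≢ root × parent s ≡ t) ⊎ (t ≢ root × parent t ≡ s)
  treeEnds (v , v≢r , refl) j = match (treeEdge-joins v v≢r) j
    where
      match : ∀ {p q} → Joins G (treeEdge v) v (parent v) → Joins G (treeEdge v) p q →
              (p ≢ root × parent p ≡ q) ⊎ (q ≢ root × parent q ≡ p)
      match (inj₁ a) (inj₁ b) with ,-injective (trans (sym b) a)
      ... | refl , refl = inj₁ (v≢r , refl)
      match (inj₁ a) (inj₂ b) with ,-injective (trans (sym b) a)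
      ... | refl , refl = inj₂ (v≢r , refl)
      match (inj₂ a) (inj₁ b) with ,-injective (trans (sym b) a)
      ... | refl , refl = inj₂ (v≢r , refl)
      match (inj₂ a) (inj₂ b) with ,-injective (trans (sym b) a)
      ... | refl , refl = inj₁ (v≢r , refl)

  edgeComparable : ∀ {e s t} → Joins G e s t → Anc s t ⊎ Anc t s
  edgeComparable {e} j with isTree? e
  ... | yes tr with treeEnds tr j
  ...   | inj₁ (s≢r , refl) = inj₂ (anc-parent s≢r)
  ...   | inj₂ (t≢r , refl) = inj₁ (anc-parent t≢r)
  edgeComparable {e} (inj₁ eq) | no ntr =
    subst (λ p → Anc (proj₁ p) (proj₂ p) ⊎ Anc (proj₂ p) (proj₁ p)) eq (nontree-ancestral e ntr)
  edgeComparable {e} (inj₂ eq) | no ntr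
    with subst (λ p → Anc (proj₁ p) (proj₂ p) ⊎ Anc (proj₂ p) (proj₁ p)) eq (nontree-ancestral e ntr)
  ... | inj₁ t≤s = inj₂ t≤s
  ... | inj₂ s≤t = inj₁ s≤t

  leavesUpwards : ∀ {e s t d} → Joins G e s t → Anc d s → ¬ Anc d t → d ≢ root →
                  Anc t (parent d)
  leavesUpwards {t = t} {d} j d≤s d≰t d≢r with edgeComparable j
  ... | inj₁ s≤t = ⊥-elim (d≰t (anc-trans d≤s s≤t))
  ... | inj₂ t≤s with anc-cmp t≤s d≤s
  ...   | inj₂ d≤t = ⊥-elim (d≰t d≤t)
  ...   | inj₁ t≤d with t ≟ d
  ...     | yes refl = ⊥-elim (d≰t anc-refl)
  ...     | no t≢d = proj₂ (anc-proper t≤d t≢d)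

  leavingIsBackEdge : ∀ {e s t d} → Joins G e s t → Anc d s → ¬ Anc d t →
                      t ≢ parent d → ¬ IsTreeEdge e
  leavingIsBackEdge {s = s} {t} {d} j d≤s d≰t t≢pd tr with treeEnds tr j
  ... | inj₂ (t≢r , refl) = d≰t (anc-step t≢r d≤s)
  ... | inj₁ (s≢r , refl) with d ≟ s
  ...   | yes refl = t≢pd refl
  ...   | no d≢s = d≰t (proj₂ (anc-proper d≤s d≢s))

  topBotJoins : ∀ e → Joins G e (top e) (bot e)
  topBotJoins e = orient (ends e) refl
    where
      orient : ∀ p → ends e ≡ p →
               Joins G e (if time (proj₁ p) ≤ᵇ time (proj₂ p) then proj₁ p else proj₂ p)
                         (if time (proj₁ p) ≤ᵇ time (proj₂ p) then proj₂ p else proj₁ p)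
      orient (a , b) eq with time a ≤ᵇ time b
      ... | true  = inj₁ eq
      ... | false = inj₂ eq

  topBot : ∀ {e a b} → Joins G e a b → time a < time b → top e ≡ a × bot e ≡ b
  topBot {e} (inj₁ eq) a<b rewrite eq | ≤ᵇ-true (<⇒≤ a<b) = refl , refl
  topBot {e} (inj₂ eq) a<b rewrite eq | ≤ᵇ-false a<b = refl , refl

  edgeSearch : (P : Fin n → Fin n → Set) → (∀ s t → Dec (P s t)) →
               (Σ (Fin m) λ e → Σ (Fin n) λ s → Σ (Fin n) λ t → Joins G e s t × P s t) ⊎
               (∀ e s t → Joins G e s t → ¬ P s t)
  edgeSearch P P? with any? (λ e → P? (proj₁ (ends e)) (proj₂ (ends e))
                                     ⊎-dec P? (proj₂ (ends e)) (proj₁ (ends e)))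
  ... | yes (e , inj₁ p) = inj₁ (e , _ , _ , inj₁ refl , p)
  ... | yes (e , inj₂ p) = inj₁ (e , _ , _ , inj₂ refl , p)
  ... | no none = inj₂ absent
    where
      absent : ∀ e s t → Joins G e s t → ¬ P s t
      absent e s t (inj₁ eq) p = none (e , inj₁ (subst (λ q → P (proj₁ q) (proj₂ q)) (sym eq) p))
      absent e s t (inj₂ eq) p = none (e , inj₂ (subst (λ q → P (proj₂ q) (proj₁ q)) (sym eq) p))

  module _ {R : Fin n → Set} where
    reach-start : ∀ {u v} → Reach G R u v → ¬ R u
    reach-start (here u∉R) = u∉R
    reach-start (step _ _ u∉R _) = u∉R

    reach-trans : ∀ {u v w} → Reach G R u v → Reach G R v w → Reach G R u w
    reach-trans (here _) q = q
    reach-trans (step e j u∉R p) q = step e j u∉R (reach-trans p q)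

    reach-sym : ∀ {u v} → Reach G R u v → Reach G R v u
    reach-sym (here u∉R) = here u∉R
    reach-sym (step e j u∉R p) =
      reach-trans (reach-sym p) (step e (joins-sym j) (reach-start p) (here u∉R))

    treePath : ∀ {a w} → Anc a w → (∀ z → Anc a z → Anc z w → ¬ R z) → Reach G R w a
    treePath anc-refl avoids = here (avoids _ anc-refl anc-refl)
    treePath {w = w} (anc-step w≢r a≤pw) avoids =
      step (treeEdge w) (treeEdge-joins w w≢r) (avoids w (anc-step w≢r a≤pw) anc-refl)
           (treePath a≤pw (λ z a≤z z≤pw → avoids z a≤z (anc-step w≢r z≤pw)))

  reach-mono : ∀ {R R' : Fin n → Set} → (∀ w → R' w → R w) →
               ∀ {u v} → Reach G R u v → Reach G R' u v
  reach-mono R'⊆R (here u∉R) = here (u∉R ∘ R'⊆R _)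
  reach-mono R'⊆R (step e j u∉R p) = step e j (u∉R ∘ R'⊆R _) (reach-mono R'⊆R p)

  record Exit (S R : Fin n → Set) (u : Fin n) : Set where
    constructor exit
    field
      inner outer : Fin n
      edge : Fin m
      joins : Joins G edge inner outer
      inner∈S : S inner
      outer∉S : ¬ S outer
      outer∉R : ¬ R outer
      path : Reach G (λ w → ¬ S w) u inner

  leave : (S : Fin n → Set) → (∀ w → Dec (S w)) → ∀ {R u v} →
          Reach G R u v → S u → ¬ S v → Exit S R u
  leave S S? (here _) u∈S v∉S = ⊥-elim (v∉S u∈S)
  leave S S? (step {v = w} e j _ p) u∈S v∉S with S? w
  ... | no w∉S = exit _ _ e j u∈S w∉S (reach-start p) (here (λ u∉S → u∉S u∈S))
  ... | yes w∈S with leave S S? p w∈S v∉S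
  ...   | exit s t f j' s∈S t∉S t∉R q = exit s t f j' s∈S t∉S t∉R (step e j (λ u∉S → u∉S u∈S) q)

  insideAvoids : ∀ {S R' : Fin n → Set} → (∀ w → S w → ¬ R' w) →
                 ∀ {u v} → Reach G (λ w → ¬ S w) u v → Reach G R' u v
  insideAvoids disjoint = reach-mono (λ w r w∈S → disjoint w w∈S r)

  walk-anc : ∀ vis → vis root ≡ true → ∀ k w {u} → u ∈ walk vis k w → Anc u w
  walk-anc vis vr zero w (here refl) = anc-refl
  walk-anc vis vr (suc k) w u∈ with vis w in vw
  walk-anc vis vr (suc k) w (here refl) | true = anc-refl
  walk-anc vis vr (suc k) w (here refl) | false = anc-refl
  walk-anc vis vr (suc k) w (there u∈) | false =
    anc-step unvisited≢root (walk-anc vis vr k (parent w) u∈)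
    where
      unvisited≢root : w ≢ root
      unvisited≢root refl with trans (sym vr) vw
      ... | ()

  walk-head : ∀ vis k w → w ∈ walk vis k w
  walk-head vis zero w = here refl
  walk-head vis (suc k) w with vis w
  ... | true  = here refl
  ... | false = here refl

  depth : ∀ {a w} → Anc a w → ℕ
  depth anc-refl = zero
  depth (anc-step _ a≤pw) = suc (depth a≤pw)

  pathVertex : ∀ {a w} (p : Anc a w) → Fin (suc (depth p)) → Fin n
  pathVertex {w = w} p Fin.zero = w
  pathVertex (anc-step _ a≤pw) (Fin.suc i) = pathVertex a≤pw i

  pathVertex-time : ∀ {a w} (p : Anc a w) i → time (pathVertex p i) ≤ time w
  pathVertex-time p Fin.zero = ≤-refl
  pathVertex-time (anc-step {v = w} w≢r a≤pw) (Fin.suc i) =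
    <⇒≤ (≤-<-trans (pathVertex-time a≤pw i) (parent-earlier w w≢r))

  pathVertex-strict : ∀ {a w} (p : Anc a w) i j → Fin.toℕ i < Fin.toℕ j →
                      time (pathVertex p j) < time (pathVertex p i)
  pathVertex-strict (anc-step {v = w} w≢r a≤pw) Fin.zero (Fin.suc j) _ =
    ≤-<-trans (pathVertex-time a≤pw j) (parent-earlier w w≢r)
  pathVertex-strict (anc-step _ a≤pw) (Fin.suc i) (Fin.suc j) (s≤s i<j) =
    pathVertex-strict a≤pw i j i<j

  -- Tree paths have distinct vertices, so fewer than n edges (pigeonhole).
  depth<n : ∀ {a w} (p : Anc a w) → depth p < n
  depth<n p with n <? suc (depth p)
  ... | no ¬n<len = ≮⇒≥ ¬n<len
  ... | yes n<len with pigeonhole n<len (pathVertex p)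
  ...   | i , j , i<j , same = ⊥-elim (<-irrefl (cong time (sym same)) (pathVertex-strict p i j i<j))

  walk-reaches : ∀ vis {z w} (p : Anc z w) k → depth p ≤ k →
                 (∀ u → Anc z u → Anc u w → u ≢ z → vis u ≡ false) → z ∈ walk vis k w
  walk-reaches vis {z} {w} p k len unvisited with z ≟ w
  ... | yes refl = walk-head vis k w
  walk-reaches vis anc-refl k len unvisited | no z≢w = ⊥-elim (z≢w refl)
  walk-reaches vis {z} {w} (anc-step w≢r z≤pw) (suc k) (s≤s len) unvisited | no z≢w
    rewrite unvisited w (anc-step w≢r z≤pw) anc-refl (z≢w ∘ sym) =
      there (walk-reaches vis z≤pw k len
               (λ u z≤u u≤pw → unvisited u z≤u (anc-step w≢r u≤pw)))

  climb : ∀ vis {z w} → Anc z w →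
          (∀ u → Anc z u → Anc u w → u ≢ z → vis u ≡ false) → z ∈ walk vis n w
  climb vis z≤w = walk-reaches vis z≤w n (<⇒≤ (depth<n z≤w))

  visitedAt : (Fin n → Bool) → Fin m → Fin n → Bool
  visitedAt iv e u = (time u ≤ᵇ time (top e)) ∨ iv u

  -- The chain of e; it is definitionally the entry chainsFrom produces for e.
  chainOf : (Fin n → Bool) → Fin m → List (Fin n)
  chainOf iv e = top e ∷ walk (visitedAt iv e) n (bot e)

  -- The root is always visited, so walks stop there at the latest.
  visitedRoot : ∀ iv e → visitedAt iv e root ≡ true
  visitedRoot iv e rewrite ≤ᵇ-true (anc-time (rootAnc (top e))) = refl

  notListed : ∀ u (W : List (Fin n)) → ¬ u ∈ W → any (λ z → ⌊ z ≟ u ⌋) W ≡ false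
  notListed u [] _ = refl
  notListed u (z ∷ W) u∉ with z ≟ u
  ... | yes z≡u = ⊥-elim (u∉ (here (sym z≡u)))
  ... | no _ = notListed u W (u∉ ∘ there)

  Unvisited : Fin n → (Fin n → Bool) → Set
  Unvisited d iv = ∀ u → Anc d u → iv u ≡ false

  Low : Fin n → ℕ → Fin m → Set
  Low d θ f = time (top f) < θ × Anc d (bot f)

  low? : ∀ d θ f → Dec (Low d θ f)
  low? d θ f = (time (top f) <? θ) ×-dec anc? d (bot f)

  -- The first low back-edge in a list sorted by top times: all earlier
  -- back-edges have their lower end outside the subtree of d, so their
  -- chains leave that subtree unvisited.
  firstLow : ∀ d θ (l : List (Fin m)) → AllPairs (λ e f → time (top e) ≤ time (top f)) l →
             ∀ iv → Unvisited d iv → Any (Low d θ) l →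
             Σ (Fin m) λ e → Σ (Fin n → Bool) λ iv' →
               Low d θ e × Unvisited d iv' × chainOf iv' e ∈ chainsFrom iv l
  firstLow d θ (f ∷ l) (f≤l ∷ sorted) iv unv found with low? d θ f
  ... | yes f-low = f , iv , f-low , unv , here refl
  ... | no ¬f-low with found
  ...   | here f-low = ⊥-elim (¬f-low f-low)
  ...   | there found' with firstLow d θ l sorted _ unv' found'
    where
      top<θ : time (top f) < θ
      top<θ = lookupWith {R = λ _ → time (top f) < θ}
                         (λ f≤g g-low → ≤-<-trans f≤g (proj₁ g-low)) f≤l found'
      unv' : Unvisited d (λ u → iv u ∨ any (λ z → ⌊ z ≟ u ⌋) (walk (visitedAt iv f) n (bot f)))
      unv' u d≤u rewrite unv u d≤u =
        notListed u _ (λ u∈W → ¬f-low (top<θ , anc-trans d≤u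
                         (walk-anc (visitedAt iv f) (visitedRoot iv f) n (bot f) u∈W)))
  ...     | e , iv' , e-low , unv'' , e∈ = e , iv' , e-low , unv'' , there e∈

  climbChain : ∀ {d iv e z} → Unvisited d iv → time (top e) < time d → Anc z (bot e) →
               (∀ u → Anc z u → Anc u (bot e) → u ≢ z → Anc d u) → z ∈ chainOf iv e
  climbChain {d} {iv} {e} {z} unv top<d z≤b inSubtree =
    there (climb (visitedAt iv e) z≤b unvisited)
    where
      unvisited : ∀ u → Anc z u → Anc u (bot e) → u ≢ z → visitedAt iv e u ≡ false
      unvisited u z≤u u≤b u≢z with d≤u ← inSubtree u z≤u u≤b u≢z
        rewrite unv u d≤u | ≤ᵇ-false (<-≤-trans top<d (anc-time d≤u)) = refl

  Pair : Fin n → Fin n → Fin n → Set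
  Pair x y w = w ≡ x ⊎ w ≡ y

  swapPair : ∀ {x y} w → Pair y x w → Pair x y w
  swapPair w (inj₁ w≡y) = inj₂ w≡y
  swapPair w (inj₂ w≡x) = inj₁ w≡x

  swapSeparation : ∀ {x y} → SeparationPair G x y → SeparationPair G y x
  swapSeparation {x} {y} (x≢y , u , v , u∉ , v∉ , disconnected) =
    x≢y ∘ sym , u , v , u∉ ∘ swapPair u , v∉ ∘ swapPair v ,
    disconnected ∘ reach-mono (swapPair {y} {x})

  toRoot : ∀ {x y u} → ¬ Anc x u → ¬ Anc y u → Reach G (Pair x y) u root
  toRoot {x} {y} {u} x≰u y≰u = treePath (rootAnc u) avoids
    where
      avoids : ∀ z → Anc root z → Anc z u → ¬ Pair x y z
      avoids z _ z≤u (inj₁ refl) = x≰u z≤u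
      avoids z _ z≤u (inj₂ refl) = y≰u z≤u

  middleToChild : ∀ {x y c u} → c ≢ root → parent c ≡ x → Anc c u → ¬ Anc y u →
                  Reach G (Pair x y) u c
  middleToChild {x} {y} {c} {u} c≢r pc c≤u y≰u = treePath c≤u avoids
    where
      avoids : ∀ z → Anc c z → Anc z u → ¬ Pair x y z
      avoids z c≤z _ (inj₁ refl) = <-irrefl refl (belowChild c≢r pc c≤z)
      avoids z _ z≤u (inj₂ refl) = y≰u z≤u

  module Main (bes : List (Fin m)) (order : BackEdgeOrder bes)
              (noCut : ∀ z → ConnectedWithout G (λ w → w ≡ z)) where
    open BackEdgeOrder order

    CommonChain : Fin n → Fin n → Set
    CommonChain x y = Σ (List (Fin n)) λ C → C ∈ chainDecomposition bes × x ∈ C × y ∈ C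

    record BackEdgeAbove (d : Fin n) : Set where
      constructor backEdgeAbove
      field
        edge : Fin m
        nontree : ¬ IsTreeEdge edge
        bot-below : Anc d (bot edge)
        top-above : Anc (top edge) (parent d)
        top≢parent : top edge ≢ parent d

    -- As parent d is not a cut vertex, the subtree of d is joined to any
    -- other vertex v outside it, so some back-edge climbs above parent d.
    leavingBackEdge : ∀ {d v} → d ≢ root → ¬ Anc d v → v ≢ parent d → BackEdgeAbove d
    leavingBackEdge {d} {v} d≢r d≰v v≢pd =
      fromExit (leave (Anc d) (anc? d) (noCut (parent d) d v d≢pd v≢pd) anc-refl d≰v)
      where
        d≢pd : d ≢ parent d
        d≢pd = before⇒≢ (parent-earlier d d≢r) ∘ sym

        fromExit : Exit (Anc d) (λ w → w ≡ parent d) d → BackEdgeAbove d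
        fromExit (exit s t e j d≤s d≰t t≢pd _)
          with t≤pd ← leavesUpwards j d≤s d≰t d≢r
          with topBot (joins-sym j) (≤-<-trans (anc-time t≤pd)
                  (<-≤-trans (parent-earlier d d≢r) (anc-time d≤s)))
        ... | refl , refl =
          backEdgeAbove e (leavingIsBackEdge j d≤s d≰t t≢pd) d≤s t≤pd t≢pd

    record LowChain (d : Fin n) (θ : ℕ) : Set where
      constructor lowChain
      field
        edge : Fin m
        visited : Fin n → Bool
        low : Low d θ edge
        unvisited : Unvisited d visited
        member : chainOf visited edge ∈ chainDecomposition bes

    firstLowChain : ∀ {d θ} e → ¬ IsTreeEdge e → Low d θ e → LowChain d θ
    firstLowChain {d} {θ} e ntr e-low
      with firstLow d θ bes sorted (λ _ → false) (λ _ _ → refl) (lose (complete e ntr) e-low)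
    ... | f , iv , f-low , unv , f∈ = lowChain f iv f-low unv f∈

    -- A subtree below a child d of y that is attached to G only at x and
    -- at y: its first leaving back-edge starts at x and its chain reaches y.
    attachedSubtree : ∀ {x y d} → time x < time y → d ≢ root → parent d ≡ y →
                      (∀ e s t → Joins G e s t → Anc d s → ¬ Anc d t → t ≡ x ⊎ t ≡ y) →
                      CommonChain x y
    attachedSubtree {x} {y} {d} x<y d≢r refl attached =
      fromFirst (firstLowChain edge nontree (s≤s (≤-reflexive (cong time top≡x)) , bot-below))
      where
        y<d : time y < time d
        y<d = parent-earlier d d≢r

        topIsX : ∀ {e} → Anc d (bot e) → ¬ Anc d (top e) → top e ≢ parent d → top e ≡ x
        topIsX {e} d≤b d≰t t≢y with attached e _ _ (joins-sym (topBotJoins e)) d≤b d≰t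
        ... | inj₁ t≡x = t≡x
        ... | inj₂ t≡y = ⊥-elim (t≢y t≡y)

        open BackEdgeAbove (leavingBackEdge {v = x} d≢r (before⇒¬below (<-trans x<y y<d))
                                                       (before⇒≢ x<y))

        top≡x : top edge ≡ x
        top≡x = topIsX bot-below (before⇒¬below (≤-<-trans (anc-time top-above) y<d)) top≢parent

        fromFirst : LowChain d (suc (time x)) → CommonChain x (parent d)
        fromFirst (lowChain f iv (f-top≤x , d≤fb) unv f∈) =
          chainOf iv f , f∈ , here (sym f-top≡x) ,
          climbChain unv f-top<d (anc-trans (anc-parent d≢r) d≤fb)
            (λ u y≤u u≤b u≢y → childOnPath d≢r refl d≤fb y≤u u≤b u≢y)
          where
            f-top<y : time (top f) < time (parent d)
            f-top<y = ≤-<-trans (≤-pred f-top≤x) x<y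

            f-top<d : time (top f) < time d
            f-top<d = <-trans f-top<y y<d

            f-top≡x : top f ≡ x
            f-top≡x = topIsX d≤fb (before⇒¬below f-top<d) (before⇒≢ f-top<y)

    Bypass : Fin n → Fin n → Fin n → Set
    Bypass x y c = Σ (Fin n) λ b → Σ (Fin n) λ a → Σ (Fin m) λ e →
                   Joins G e b a × Anc c b × ¬ Anc y b × time a < time x

    lowpointOrChain : ∀ {x y c} → x ≢ root → c ≢ root → parent c ≡ x → Anc c y →
                      CommonChain x y ⊎ Bypass x y c
    lowpointOrChain {x} {y} {c} x≢r c≢r refl c≤y =
      fromFirst (firstLowChain edge nontree (top<x , bot-below))
      where
        open BackEdgeAbove (leavingBackEdge {v = root} c≢r (c≢r ∘ anc-root) (x≢r ∘ sym))

        top<x : time (top edge) < time (parent c)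
        top<x = ≤∧≢⇒< (anc-time top-above) (top≢parent ∘ time-injective _ _)

        fromFirst : LowChain c (time (parent c)) → CommonChain (parent c) y ⊎ Bypass (parent c) y c
        fromFirst (lowChain f iv (f-top<x , c≤fb) unv f∈) with anc? y (bot f)
        ... | no y≰fb = inj₂ (bot f , top f , f , joins-sym (topBotJoins f) , c≤fb , y≰fb , f-top<x)
        ... | yes y≤fb = inj₁ (chainOf iv f , f∈ ,
                climbChain unv f-top<c (anc-trans (anc-parent c≢r) c≤fb)
                  (λ u x≤u u≤b u≢x → childOnPath c≢r refl c≤fb x≤u u≤b u≢x) ,
                climbChain unv f-top<c y≤fb (λ u y≤u _ _ → anc-trans c≤y y≤u))
          where
            f-top<c : time (top f) < time c
            f-top<c = <-trans f-top<x (parent-earlier c c≢r)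

    -- A vertex u in the subtree of a child c' of x escapes, in G − x − y,
    -- to a proper ancestor of x, provided y is neither in that subtree nor
    -- an ancestor of x: as x is no cut vertex, u reaches some v outside the
    -- subtree, and the path leaves it upwards.
    escapeSubtree : ∀ {x y c' u v} → c' ≢ root → parent c' ≡ x → ¬ Anc c' y → ¬ Anc y x →
                    Anc c' u → ¬ Anc c' v → v ≢ x →
                    Σ (Fin n) λ t → Anc t x × t ≢ x × Reach G (Pair x y) u t
    escapeSubtree {x} {y} {c'} {u} {v} c'≢r pc' c'≰y y≰x c'≤u c'≰v v≢x =
      fromExit (leave (Anc c') (anc? c') (noCut x u v u≢x v≢x) c'≤u c'≰v)
      where
        avoids : ∀ w → Anc c' w → ¬ Pair x y w
        avoids w c'≤w (inj₁ refl) = <-irrefl refl (belowChild c'≢r pc' c'≤w)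
        avoids w c'≤w (inj₂ refl) = c'≰y c'≤w

        u≢x : u ≢ x
        u≢x refl = avoids u c'≤u (inj₁ refl)

        fromExit : Exit (Anc c') (λ w → w ≡ x) u → Σ (Fin n) λ t → Anc t x × t ≢ x × Reach G (Pair x y) u t
        fromExit (exit s t e j c'≤s c'≰t t≢x path) = t , t≤x , t≢x ,
          reach-trans (insideAvoids avoids path) (step e j (avoids s c'≤s) (here t∉))
          where
            t≤x : Anc t x
            t≤x = subst (Anc t) pc' (leavesUpwards j c'≤s c'≰t c'≢r)

            t∉ : ¬ Pair x y t
            t∉ (inj₁ t≡x) = t≢x t≡x
            t∉ (inj₂ refl) = y≰x t≤x

    -- Connectivity of G − x − y for a proper ancestor x of y with child c
    -- towards y, given a hub h (the root, or c if x is the root) reached by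
    -- the vertices above x and the vertices between x and y.
    module Nested (x y c h : Fin n) (x≤y : Anc x y) (x≢y : x ≢ y)
                  (c≢r : c ≢ root) (pc : parent c ≡ x) (c≤y : Anc c y)
                  (hubPlacement : ¬ Anc x h ⊎ h ≡ c)
                  (hubAbove : ∀ u → ¬ Anc x u → Reach G (Pair x y) u h)
                  (hubMiddle : ∀ u → Anc c u → ¬ Anc y u → Reach G (Pair x y) u h) where

      x<y : time x < time y
      x<y = ≤∧≢⇒< (anc-time x≤y) (x≢y ∘ time-injective _ _)

      y≰x : ¬ Anc y x
      y≰x y≤x = x≢y (anc-antisym x≤y y≤x)

      h≢x : h ≢ x
      h≢x h≡x = [ (λ x≰h → x≰h (subst (Anc x) (sym h≡x) anc-refl))
                , (λ h≡c → <-irrefl (cong time (trans (sym h≡x) h≡c)) (belowChild c≢r pc anc-refl))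
                ]′ hubPlacement

      sideToHub : ∀ u → Anc x u → u ≢ x → ¬ Anc c u → Reach G (Pair x y) u h
      sideToHub u x≤u u≢x c≰u with childOf x≤u (u≢x ∘ sym)
      ... | c' , c'≢r , pc' , c'≤u = viaEscape (escapeSubtree c'≢r pc' c'≰y y≰x c'≤u c'≰h h≢x)
        where
          isC : ∀ {w} → Anc c' w → Anc c w → c' ≡ c
          isC = siblingsDisjoint (trans pc' (sym pc)) c'≢r c≢r

          c'≰y : ¬ Anc c' y
          c'≰y c'≤y with refl ← isC c'≤y c≤y = c≰u c'≤u

          c'≰h : ¬ Anc c' h
          c'≰h c'≤h = [ (λ x≰h → x≰h (anc-trans (subst (λ z → Anc z c') pc' (anc-parent c'≢r)) c'≤h))
                      , (λ h≡c → c≰u (subst (λ z → Anc z u) (isC (subst (Anc c') h≡c c'≤h) anc-refl) c'≤u))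
                      ]′ hubPlacement

          viaEscape : (Σ (Fin n) λ t → Anc t x × t ≢ x × Reach G (Pair x y) u t) →
                      Reach G (Pair x y) u h
          viaEscape (t , t≤x , t≢x , u→t) = reach-trans u→t (hubAbove t (t≢x ∘ anc-antisym t≤x))

      ancestorToHub : ∀ t → Anc t y → t ≢ y → t ≢ x → Reach G (Pair x y) t h
      ancestorToHub t t≤y t≢y t≢x with anc? x t
      ... | no x≰t = hubAbove t x≰t
      ... | yes x≤t = hubMiddle t (childOnPath c≢r pc c≤y x≤t t≤y t≢x)
                                  (λ y≤t → t≢y (anc-antisym t≤y y≤t))

      Escape : Fin n → Fin n → Fin n → Set
      Escape d s t = Anc d s × ¬ Anc d t × t ≢ x × t ≢ y

      escape? : ∀ d s t → Dec (Escape d s t)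
      escape? d s t = anc? d s ×-dec ¬? (anc? d t) ×-dec ¬? (t ≟ x) ×-dec ¬? (t ≟ y)

      -- Vertices below y reach the hub through an escaping edge of their
      -- subtree; without one, that subtree puts x and y on a common chain.
      belowToHub : ∀ u → Anc y u → u ≢ y → Reach G (Pair x y) u h ⊎ CommonChain x y
      belowToHub u y≤u u≢y with childOf y≤u (u≢y ∘ sym)
      ... | d , d≢r , pd , d≤u with edgeSearch (Escape d) (escape? d)
      ...   | inj₂ none = inj₂ (attachedSubtree x<y d≢r pd attached)
        where
          attached : ∀ e s t → Joins G e s t → Anc d s → ¬ Anc d t → t ≡ x ⊎ t ≡ y
          attached e s t j d≤s d≰t with t ≟ x | t ≟ y
          ... | yes t≡x | _ = inj₁ t≡x
          ... | no _ | yes t≡y = inj₂ t≡y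
          ... | no t≢x | no t≢y = ⊥-elim (none e s t j (d≤s , d≰t , t≢x , t≢y))
      ...   | inj₁ (e , s , t , j , d≤s , d≰t , t≢x , t≢y) =
        inj₁ (reach-trans (treePath d≤u inSubtree)
               (reach-trans (reach-sym (treePath d≤s inSubtree))
                 (step e j (inSubtree s d≤s anc-refl)
                   (ancestorToHub t (subst (Anc t) pd (leavesUpwards j d≤s d≰t d≢r)) t≢y t≢x))))
        where
          inSubtree : ∀ {w} z → Anc d z → Anc z w → ¬ Pair x y z
          inSubtree z d≤z _ (inj₁ refl) = <⇒≱ (<-trans x<y (belowChild d≢r pd d≤z)) ≤-refl
          inSubtree z d≤z _ (inj₂ refl) = <-irrefl refl (belowChild d≢r pd d≤z)

      toHub : ∀ u → ¬ Pair x y u → Reach G (Pair x y) u h ⊎ CommonChain x y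
      toHub u u∉ with anc? x u
      ... | no x≰u = inj₁ (hubAbove u x≰u)
      ... | yes x≤u with anc? c u
      ...   | no c≰u = inj₁ (sideToHub u x≤u (u∉ ∘ inj₁) c≰u)
      ...   | yes c≤u with anc? y u
      ...     | no y≰u = inj₁ (hubMiddle u c≤u y≰u)
      ...     | yes y≤u = belowToHub u y≤u (u∉ ∘ inj₂)

      -- Since G − x − y is disconnected, some vertex misses the hub.
      commonChain : SeparationPair G x y → CommonChain x y
      commonChain (_ , u , v , u∉ , v∉ , disconnected) with toHub u u∉ | toHub v v∉
      ... | inj₂ found | _ = found
      ... | inj₁ _ | inj₂ found = found
      ... | inj₁ u→h | inj₁ v→h = ⊥-elim (disconnected (reach-trans u→h (reach-sym v→h)))

    nestedPair : ∀ {x y} → Anc x y → SeparationPair G x y → CommonChain x y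
    nestedPair {x} {y} x≤y sp@(x≢y , _) with childOf x≤y x≢y
    ... | c , c≢r , pc , c≤y with x ≟ root
    ...   | yes refl =
      Nested.commonChain x y c c x≤y x≢y c≢r pc c≤y (inj₂ refl)
        (λ u x≰u → ⊥-elim (x≰u (rootAnc u)))
        (λ u c≤u y≰u → middleToChild c≢r pc c≤u y≰u) sp
    ...   | no x≢r with lowpointOrChain x≢r c≢r pc c≤y
    ...     | inj₁ found = found
    ...     | inj₂ (b , a , e , j , c≤b , y≰b , a<x) =
      Nested.commonChain x y c root x≤y x≢y c≢r pc c≤y (inj₁ (x≢r ∘ anc-root))
        aboveToRoot middleToRoot sp
      where
        aboveToRoot : ∀ u → ¬ Anc x u → Reach G (Pair x y) u root
        aboveToRoot u x≰u = toRoot x≰u (x≰u ∘ anc-trans x≤y)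

        -- through c, down to b and across the bypass to a
        middleToRoot : ∀ u → Anc c u → ¬ Anc y u → Reach G (Pair x y) u root
        middleToRoot u c≤u y≰u =
          reach-trans (middleToChild c≢r pc c≤u y≰u)
            (reach-trans (reach-sym b→c)
              (step e j (reach-start b→c) (aboveToRoot a (before⇒¬below a<x))))
          where
            b→c : Reach G (Pair x y) b c
            b→c = middleToChild c≢r pc c≤b y≰b

    -- Incomparable vertices never form a separation pair: everything
    -- reaches the root in G − x − y.
    incomparable : ∀ {x y} → ¬ Anc x y → ¬ Anc y x → ¬ SeparationPair G x y
    incomparable {x} {y} x≰y y≰x (_ , u , v , u∉ , v∉ , disconnected) =
      disconnected (reach-trans (reachRoot u u∉) (reach-sym (reachRoot v v∉)))
      where
        -- a vertex strictly below a escapes above a, hence reaches the root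
        belowFirst : ∀ {a b w} → ¬ Anc a b → ¬ Anc b a → Anc a w → w ≢ a →
                     Reach G (Pair a b) w root
        belowFirst {a} {b} {w} a≰b b≰a a≤w w≢a with childOf a≤w (w≢a ∘ sym)
        ... | c' , c'≢r , pc' , c'≤w =
          viaEscape (escapeSubtree c'≢r pc'
                       (a≰b ∘ anc-trans (subst (λ z → Anc z c') pc' (anc-parent c'≢r)))
                       b≰a c'≤w (c'≢r ∘ anc-root)
                       (λ r≡a → a≰b (subst (λ z → Anc z b) r≡a (rootAnc b))))
          where
            viaEscape : (Σ (Fin n) λ t → Anc t a × t ≢ a × Reach G (Pair a b) w t) →
                        Reach G (Pair a b) w root
            viaEscape (t , t≤a , t≢a , w→t) =
              reach-trans w→t (toRoot (t≢a ∘ anc-antisym t≤a) (λ b≤t → b≰a (anc-trans b≤t t≤a)))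

        reachRoot : ∀ w → ¬ Pair x y w → Reach G (Pair x y) w root
        reachRoot w w∉ with anc? x w | anc? y w
        ... | yes x≤w | _ = belowFirst x≰y y≰x x≤w (w∉ ∘ inj₁)
        ... | no _ | yes y≤w = reach-mono (swapPair {y} {x}) (belowFirst y≰x x≰y y≤w (w∉ ∘ inj₂))
        ... | no x≰w | no y≰w = toRoot x≰w y≰w

    onCommonChain : ∀ x y → SeparationPair G x y → CommonChain x y
    onCommonChain x y sp with anc? x y | anc? y x
    ... | yes x≤y | _ = nestedPair x≤y sp
    ... | no x≰y | no y≰x = ⊥-elim (incomparable x≰y y≰x sp)
    ... | no _ | yes y≤x with C , C∈ , y∈C , x∈C ← nestedPair y≤x (swapSeparation sp) = C , C∈ , x∈C , y∈C

lemma18 : (G : Multigraph) → MinDegree≥3 G → TwoConnected G →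
          (T : DFSTree G) → (bes : List (Fin (Multigraph.m G))) →
          DFSTree.BackEdgeOrder T bes →
          (x y : Fin (Multigraph.n G)) → SeparationPair G x y →
          Σ (List (Fin (Multigraph.n G))) λ C →
            C ∈ DFSTree.chainDecomposition T bes × x ∈ C × y ∈ C
lemma18 G _ (_ , _ , noCut) T bes order = DFS.Main.onCommonChain G T bes order noCut
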